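{- Let $q\ge3$ be an odd integer and let $h$ be the function on positive integers defined by $h(j)=j$ for $1\le j\le q$ and, for $n\ge q$, $$h(n+1)=\begin{cases}h(n)+1,&\text{if } q\nmid n;\\[2pt] h(n)\Big(1-\dfrac{1}{h(\frac{n}{q}+1)}\Big)+1,&\text{if } q\mid n.\end{cases}$$ Then for every integer $n\ge1$, $$h(n)\ge\Big\lfloor\frac{\log n}{\log q}\Big\rfloor.$$
   Context: $\lfloor x\rfloor$ denotes the largest integer $\le x$. -}

module Defs where

open import Data.Nat as ℕ using (ℕ; suc; _^_)
open import Data.Nat.Divisibility using (_∣_)
open import Data.Integer using (+_)
open import Data.Rational using (ℚ; _/_; _+_; _*_; _-_; 1/_; NonZero; 1ℚ)
open import Data.Product using (Σ; _×_)
open import Relation.Binary.PropositionalEquality using (_≡_)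
open import Relation.Nullary using (¬_)

toℚ : ℕ → ℚ
toℚ k = (+ k) / 1

-- k = ⌊ log n / log q ⌋, i.e. k is the largest integer with q^k ≤ n
-- (for q ≥ 2 and n ≥ 1 this is the unique k with q^k ≤ n < q^(k+1))
IsFloorLog : ℕ → ℕ → ℕ → Set
IsFloorLog q n k = (q ^ k ℕ.≤ n) × (n ℕ.< q ^ suc k)

-- In the case q ∣ n we write n = m * q, so n/q + 1 = suc m; the nonzero
-- proof expresses that the term 1/h(n/q+1) is defined.
IsH : ℕ → (ℕ → ℚ) → Set
IsH q h =
  ((j : ℕ) → 1 ℕ.≤ j → j ℕ.≤ q → h j ≡ toℚ j)
  × ((n : ℕ) → q ℕ.≤ n → ¬ (q ∣ n) → h (suc n) ≡ h n + 1ℚ)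
  × ((m : ℕ) → q ℕ.≤ m ℕ.* q →
       Σ (NonZero (h (suc m))) λ nz →
         h (suc (m ℕ.* q)) ≡ h (m ℕ.* q) * (1ℚ - (1/ h (suc m)) {{nz}}) + 1ℚ)

{-# OPTIONS --safe #-}
module Submission where

-- Inside a block m q + 1, …, m q + q the function h grows by exactly 1 per step, so everything is
-- governed by the block starts s m = hStart m = h (m q + 1). Strong induction on m shows s m ≥ k + 2 whenever
-- q ^ k ≤ m. In the jump s (m + 1) = (s m + q - 1) (1 - 1 / h (m + 2)) + 1 with q ^ k ≤ m + 1, the
-- earlier block starts give s m + q - 1 ≥ k + 3 and h (m + 2) ≥ max (k + 1) 2, which is exactly what
-- 1+x≤y*[1-1/z] needs to conclude s (m + 1) ≥ k + 2.

open import Defs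
open import Data.Nat as ℕ using (ℕ; zero; suc; _^_; z≤n; s≤s; s≤s⁻¹; _≤_; _<_)
import Data.Nat.Properties as ℕ
open import Data.Nat.DivMod using (_/_; _%_; m≡m%n+[m/n]*n; m%n<n; m*n/n≡m; /-monoˡ-≤; m/n<m)
open import Data.Nat.Divisibility using (_∣_; ∣m+n∣m⇒∣n; n∣m*n; ∣⇒≤)
open import Data.Nat.Induction using (<-rec)
import Data.Nat.Coprimality as Coprime
import Data.Integer as ℤ
import Data.Integer.Properties as ℤ
import Data.Rational
open import Data.Rational as ℚ
  using (ℚ; mkℚ; *≤*; *<*; 0ℚ; 1ℚ; _+_; _*_; _-_; -_; 1/_; NonZero; Positive; NonNegative; positive; nonNegative)
open import Data.Rational.Properties
  using ( normalize-coprime; ≤-trans; ≤-reflexive; <-≤-trans; +-mono-≤; +-monoˡ-≤; +-monoʳ-≤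
        ; +-identityʳ; +-inverseʳ; +-assoc; *-inverseˡ; *-cancelʳ-≤-pos; *-monoʳ-≤-nonNeg; module ≤-Reasoning)
open import Data.Rational.Solver using (module +-*-Solver)
open import Data.Product using (_,_; proj₁; proj₂; Σ)
open import Relation.Binary.PropositionalEquality using (_≡_; refl; sym; trans; cong; cong₂; subst; module ≡-Reasoning)
open import Relation.Nullary using (¬_; yes; no; contradiction)

toℚ≡mkℚ : ∀ n → toℚ n ≡ mkℚ (ℤ.+ n) 0 (Coprime.sym (Coprime.1-coprimeTo n))
toℚ≡mkℚ n = normalize-coprime (Coprime.sym (Coprime.1-coprimeTo n))

toℚ-+ : ∀ m n → toℚ (m ℕ.+ n) ≡ toℚ m + toℚ n
toℚ-+ m n rewrite toℚ≡mkℚ m | toℚ≡mkℚ n =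
  cong (ℚ._/ 1) (sym (cong₂ ℤ._+_ (ℤ.*-identityʳ (ℤ.+ m)) (ℤ.*-identityʳ (ℤ.+ n))))

toℚ-suc : ∀ n → toℚ (suc n) ≡ toℚ n + 1ℚ
toℚ-suc n = trans (cong toℚ (ℕ.+-comm 1 n)) (toℚ-+ n 1)

toℚ-mono-≤ : ∀ {m n} → m ≤ n → toℚ m ℚ.≤ toℚ n
toℚ-mono-≤ {m} {n} m≤n rewrite toℚ≡mkℚ m | toℚ≡mkℚ n = *≤* (ℤ.*-monoʳ-≤-nonNeg (ℤ.+ 1) (ℤ.+≤+ m≤n))

toℚ-nonNeg : ∀ n → 0ℚ ℚ.≤ toℚ n
toℚ-nonNeg n = toℚ-mono-≤ {0} {n} z≤n

p≤p+q : ∀ {p q} → 0ℚ ℚ.≤ q → p ℚ.≤ p + q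
p≤p+q {p} 0≤q = ≤-trans (≤-reflexive (sym (+-identityʳ p))) (+-monoʳ-≤ p 0≤q)

p≤q⇒0≤q-p : ∀ {p q} → p ℚ.≤ q → 0ℚ ℚ.≤ q - p
p≤q⇒0≤q-p {p} p≤q = ≤-trans (≤-reflexive (sym (+-inverseʳ p))) (+-monoˡ-≤ (- p) p≤q)

-- Multiplying out by z > 0, this is (1 + x) z ≤ (3 + x)(z - 1), whose slack is (z - (1 + x)) + (z - 2).
1+x≤y*[1-1/z] : ∀ x {y z} .{{_ : NonZero z}} →
                toℚ 3 + x ℚ.≤ y → 1ℚ + x ℚ.≤ z → toℚ 2 ℚ.≤ z → 1ℚ + x ℚ.≤ y * (1ℚ - 1/ z)
1+x≤y*[1-1/z] x {y} {z} 3+x≤y 1+x≤z 2≤z = *-cancelʳ-≤-pos z (begin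
  (1ℚ + x) * z                                       ≡⟨ add-sub ((1ℚ + x) * z) (1ℚ + x + toℚ 2) ⟩
  (1ℚ + x) * z + (1ℚ + x + toℚ 2) - (1ℚ + x + toℚ 2) ≤⟨ +-monoˡ-≤ (- (1ℚ + x + toℚ 2))
                                                          (+-monoʳ-≤ ((1ℚ + x) * z) (+-mono-≤ 1+x≤z 2≤z)) ⟩
  (1ℚ + x) * z + (z + z) - (1ℚ + x + toℚ 2)          ≡⟨ regroup x z ⟩
  (toℚ 3 + x) * (z - 1ℚ)                             ≤⟨ *-monoʳ-≤-nonNeg (z - 1ℚ) 3+x≤y ⟩
  y * (z - 1ℚ)                                       ≡⟨ cong (λ w → y * (z - w)) (sym (*-inverseˡ z)) ⟩
  y * (z - 1/ z * z)                                 ≡⟨ factor y z (1/ z) ⟩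
  y * (1ℚ - 1/ z) * z                                ∎)
  where
  open ≤-Reasoning
  open +-*-Solver
  instance
    z>0 : Positive z
    z>0 = positive (<-≤-trans (*<* (ℤ.+<+ (s≤s z≤n))) 2≤z)
    z-1≥0 : NonNegative (z - 1ℚ)
    z-1≥0 = nonNegative (p≤q⇒0≤q-p (≤-trans (toℚ-mono-≤ {1} {2} (s≤s z≤n)) 2≤z))
  add-sub : ∀ a b → a ≡ a + b - b
  add-sub = solve 2 (λ a b → a := a :+ b :- b) refl
  regroup : ∀ x z → (1ℚ + x) * z + (z + z) - (1ℚ + x + toℚ 2) ≡ (toℚ 3 + x) * (z - 1ℚ)
  regroup = solve 2 (λ x z → (con 1ℚ :+ x) :* z :+ (z :+ z) :- (con 1ℚ :+ x :+ con (toℚ 2))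
                               := (con (toℚ 3) :+ x) :* (z :- con 1ℚ)) refl
  factor : ∀ y z d → y * (z - d * z) ≡ y * (1ℚ - d) * z
  factor = solve 3 (λ y z d → y :* (z :- d :* z) := y :* (con 1ℚ :- d) :* z) refl

m^[1+n]≤o⇒m^n≤o/m : ∀ {m} n {o} .{{_ : ℕ.NonZero m}} → m ^ suc n ≤ o → m ^ n ≤ o / m
m^[1+n]≤o⇒m^n≤o/m {m} n {o} m^[1+n]≤o = begin
  m ^ n           ≡⟨ m*n/n≡m (m ^ n) m ⟨
  m ^ n ℕ.* m / m ≡⟨ cong (_/ m) (ℕ.*-comm (m ^ n) m) ⟩
  m ^ suc n / m   ≤⟨ /-monoˡ-≤ m m^[1+n]≤o ⟩
  o / m           ∎
  where open ℕ.≤-Reasoning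

m^[1+n]≤1+o⇒m^n≤o : ∀ {m} n {o} → 1 < m → m ^ suc n ≤ suc o → m ^ n ≤ o
m^[1+n]≤1+o⇒m^n≤o {m} n 1<m m^[1+n]≤1+o = s≤s⁻¹ (ℕ.≤-trans (ℕ.^-monoʳ-< m 1<m (ℕ.n<1+n n)) m^[1+n]≤1+o)

n∤m*n+o : ∀ m {n o} → 0 < o → o < n → ¬ n ∣ m ℕ.* n ℕ.+ o
n∤m*n+o m {o = suc o} _ o<n n∣m*n+o = ℕ.<⇒≱ o<n (∣⇒≤ (∣m+n∣m⇒∣n n∣m*n+o (n∣m*n m)))

module _ {p : ℕ} (2≤p : 2 ≤ p) {h : ℕ → ℚ} (isH : IsH (suc p) h) where

  q : ℕ
  q = suc p

  1<q : 1 < q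
  1<q = s≤s (ℕ.≤-trans (s≤s z≤n) 2≤p)

  h-small : ∀ j → 1 ≤ j → j ≤ q → h j ≡ toℚ j
  h-small = proj₁ isH

  h-step : ∀ n → q ≤ n → ¬ q ∣ n → h (suc n) ≡ h n + 1ℚ
  h-step = proj₁ (proj₂ isH)

  h-jump : ∀ m → q ≤ m ℕ.* q →
           Σ (NonZero (h (suc m))) λ nz → h (suc (m ℕ.* q)) ≡ h (m ℕ.* q) * (1ℚ - (1/ h (suc m)) {{nz}}) + 1ℚ
  h-jump = proj₂ (proj₂ isH)

  h-suc : ∀ {n} → 1 ≤ n → ¬ q ∣ n → h (suc n) ≡ h n + 1ℚ
  h-suc {n} 1≤n q∤n with q ℕ.≤? n
  ... | yes q≤n = h-step n q≤n q∤n
  ... | no  q≰n = begin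
    h (suc n)       ≡⟨ h-small (suc n) (s≤s z≤n) (ℕ.≰⇒> q≰n) ⟩
    toℚ (suc n)     ≡⟨ toℚ-suc n ⟩
    toℚ n + 1ℚ      ≡⟨ cong (_+ 1ℚ) (h-small n 1≤n (ℕ.<⇒≤ (ℕ.≰⇒> q≰n))) ⟨
    h n + 1ℚ        ∎
    where open ≡-Reasoning

  hStart : ℕ → ℚ
  hStart m = h (suc (m ℕ.* q))

  h-block : ∀ m {j} → j < q → h (suc (m ℕ.* q ℕ.+ j)) ≡ hStart m + toℚ j
  h-block m {zero} _ = trans (cong (λ n → h (suc n)) (ℕ.+-identityʳ (m ℕ.* q))) (sym (+-identityʳ (hStart m)))
  h-block m {suc j} 1+j<q = begin
    h (suc (m ℕ.* q ℕ.+ suc j))  ≡⟨ h-suc (ℕ.≤-trans (s≤s z≤n) (ℕ.m≤n+m (suc j) (m ℕ.* q)))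
                                         (n∤m*n+o m (s≤s z≤n) 1+j<q) ⟩
    h (m ℕ.* q ℕ.+ suc j) + 1ℚ   ≡⟨ cong (λ n → h n + 1ℚ) (ℕ.+-suc (m ℕ.* q) j) ⟩
    h (suc (m ℕ.* q ℕ.+ j)) + 1ℚ ≡⟨ cong (_+ 1ℚ) (h-block m (ℕ.<-trans (ℕ.n<1+n j) 1+j<q)) ⟩
    hStart m + toℚ j + 1ℚ        ≡⟨ +-assoc (hStart m) (toℚ j) 1ℚ ⟩
    hStart m + (toℚ j + 1ℚ)      ≡⟨ cong (hStart m +_) (toℚ-suc j) ⟨
    hStart m + toℚ (suc j)       ∎
    where open ≡-Reasoning

  h-block-end : ∀ m → h (suc m ℕ.* q) ≡ hStart m + toℚ p
  h-block-end m = trans (cong (λ n → h (suc n)) (ℕ.+-comm p (m ℕ.* q))) (h-block m (ℕ.n<1+n p))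

  h-divmod : ∀ n → h (suc n) ≡ hStart (n / q) + toℚ (n % q)
  h-divmod n = trans (cong (λ n → h (suc n)) (trans (m≡m%n+[m/n]*n n q) (ℕ.+-comm (n % q) (n / q ℕ.* q))))
                     (h-block (n / q) (m%n<n n q))

  hStart≤h : ∀ n → hStart (n / q) ℚ.≤ h (suc n)
  hStart≤h n = ≤-trans (p≤p+q (toℚ-nonNeg (n % q))) (≤-reflexive (sym (h-divmod n)))

  StartBound : ℕ → Set
  StartBound m = ∀ k → q ^ k ≤ m → toℚ (2 ℕ.+ k) ℚ.≤ hStart m

  1≤hStart : ∀ {m} → StartBound m → 1ℚ ℚ.≤ hStart m
  1≤hStart {zero}  _     = ≤-reflexive (sym (h-small 1 (s≤s z≤n) (s≤s z≤n)))
  1≤hStart {suc m} bound = ≤-trans (toℚ-mono-≤ {1} {2} (s≤s z≤n)) (bound 0 (s≤s z≤n))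

  hStart-lower : ∀ {m} → StartBound m → ∀ k → q ^ k ≤ suc m → toℚ (suc k) ℚ.≤ hStart m
  hStart-lower bound zero    _       = 1≤hStart bound
  hStart-lower bound (suc k) q^k≤1+m = bound k (m^[1+n]≤1+o⇒m^n≤o k 1<q q^k≤1+m)

  h-lower : ∀ n → StartBound (n / q) → ∀ k → q ^ k ≤ n → toℚ (suc k) ℚ.≤ h (suc n)
  h-lower n bound k q^k≤n = ≤-trans (hStart-lower′ k q^k≤n) (hStart≤h n)
    where
    hStart-lower′ : ∀ k → q ^ k ≤ n → toℚ (suc k) ℚ.≤ hStart (n / q)
    hStart-lower′ zero    _     = 1≤hStart bound
    hStart-lower′ (suc k) q^k≤n = bound k (m^[1+n]≤o⇒m^n≤o/m k q^k≤n)

  2≤h : ∀ n → StartBound (n / q) → 1 ≤ n → toℚ 2 ℚ.≤ h (suc n)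
  2≤h n bound 1≤n with q ℕ.≤? n
  ... | yes q≤n = h-lower n bound 1 (subst (_≤ n) (sym (ℕ.*-identityʳ q)) q≤n)
  ... | no  q≰n = ≤-trans (toℚ-mono-≤ (s≤s 1≤n)) (≤-reflexive (sym (h-small (suc n) (s≤s z≤n) (ℕ.≰⇒> q≰n))))

  startBound-step : ∀ m → StartBound m → StartBound (suc m / q) → StartBound (suc m)
  startBound-step m bound bound′ k q^k≤1+m with h-jump (suc m) (ℕ.m≤m+n q (m ℕ.* q))
  ... | nz , jump = begin
    toℚ (2 ℕ.+ k)                          ≡⟨ toℚ-suc (suc k) ⟩
    toℚ (suc k) + 1ℚ                       ≡⟨ cong (_+ 1ℚ) (toℚ-+ 1 k) ⟩
    1ℚ + toℚ k + 1ℚ                        ≤⟨ +-monoˡ-≤ 1ℚ (1+x≤y*[1-1/z] (toℚ k) {{nz}}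
                                               (subst (ℚ._≤ a) (toℚ-+ 3 k) a-lower)
                                               (subst (ℚ._≤ b) (toℚ-+ 1 k) (h-lower (suc m) bound′ k q^k≤1+m))
                                               (2≤h (suc m) bound′ (s≤s z≤n))) ⟩
    a * (1ℚ - (1/ b) {{nz}}) + 1ℚ          ≡⟨ jump ⟨
    hStart (suc m)                         ∎
    where
    open ≤-Reasoning
    a b : ℚ
    a = h (suc m ℕ.* q)
    b = h (suc (suc m))
    a-lower : toℚ (3 ℕ.+ k) ℚ.≤ a
    a-lower = begin
      toℚ (3 ℕ.+ k)           ≤⟨ toℚ-mono-≤ (ℕ.≤-trans (ℕ.≤-reflexive (ℕ.+-comm 2 (suc k))) (ℕ.+-monoʳ-≤ (suc k) 2≤p)) ⟩
      toℚ (suc k ℕ.+ p)       ≡⟨ toℚ-+ (suc k) p ⟩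
      toℚ (suc k) + toℚ p     ≤⟨ +-monoˡ-≤ (toℚ p) (hStart-lower bound k q^k≤1+m) ⟩
      hStart m + toℚ p        ≡⟨ h-block-end m ⟨
      a                       ∎

  startBound : ∀ m → StartBound m
  startBound = <-rec StartBound step
    where
    step : ∀ m → (∀ {m′} → m′ < m → StartBound m′) → StartBound m
    step zero    _   k q^k≤0 = contradiction q^k≤0 (ℕ.<⇒≱ (ℕ.m^n>0 q k))
    step (suc m) rec         = startBound-step m (rec (ℕ.n<1+n m)) (rec (m/n<m (suc m) q 1<q))

  floorLog≤h : ∀ n k → q ^ k ≤ suc n → toℚ k ℚ.≤ h (suc n)
  floorLog≤h n zero    _       = ≤-trans (toℚ-nonNeg 1) (≤-trans (1≤hStart (startBound (n / q))) (hStart≤h n))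
  floorLog≤h n (suc k) q^k≤1+n = h-lower n (startBound (n / q)) k (m^[1+n]≤1+o⇒m^n≤o k 1<q q^k≤1+n)

lemma4 : (q : ℕ) → 3 ≤ q → ¬ (2 ∣ q) → (h : ℕ → ℚ) → IsH q h →
         (n k : ℕ) → 1 ≤ n → IsFloorLog q n k → toℚ k Data.Rational.≤ h n
lemma4 (suc p) (s≤s 2≤p) _ h isH (suc n) k _ (q^k≤n , _) = floorLog≤h 2≤p isH n k q^k≤n
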